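{- For all positive $\alpha,\delta,p$ there exists $\varepsilon=\varepsilon(\alpha,\delta)>0$ such that every $\varepsilon$-typical $(\varepsilon,p)$-regular triple $(V_1,V_2,V_3)$ of minimum density at least $\delta p$ contains $(1-\alpha)\min_i|V_i|$ vertex-disjoint triangles (each with one vertex in each of $V_1,V_2,V_3$).
   Context: For disjoint vertex sets $X,Y$, $d(X,Y)=e(X,Y)/(|X||Y|)$ with $e(X,Y)$ the number of edges between them. A pair $(V_1,V_2)$ is $(\varepsilon,p)$-regular if $|d(V_1,V_2)-d(U_1,U_2)|\le\varepsilon p$ for all $U_l\subset V_l$ with $|U_l|\ge\varepsilon|V_l|$; a triple of pairwise disjoint sets is $(\varepsilon,p)$-regular if all three pairs are. Its minimum density is $\min_{i\ne j}d(V_i,V_j)$. Write $d(V_i,V_j)=d_{ij}p$ and $\{i,j,k\}=\{1,2,3\}$. A vertex $v\in V_i$ is $\varepsilon$-typical if, with $N_l=N(v)\cap V_l$ for $l\in\{j,k\}$: $(1-\varepsilon)d_{il}p|V_l|\le|N_l|\le(1+\varepsilon)d_{il}p|V_l|$, and there exist $N_l'\subset N_l$ with $|N_l'|\ge(1-\varepsilon)|N_l|$ such that $(N_j',N_k')$ is $(\varepsilon,p)$-regular with density between $(1-\varepsilon)d_{jk}p$ and $(1+\varepsilon)d_{jk}p$. The triple is $\varepsilon$-typical if it is $(\varepsilon,p)$-regular and for each $i$, all but at most $\varepsilon|V_i|$ vertices of $V_i$ are $\varepsilon$-typical.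
   Formalization: The parameters α, δ and p range over the positive rationals, and the constant ε is taken rational. -}

module Defs where

open import Data.Bool using (Bool; true; false; _∧_; if_then_else_)
open import Data.Nat using (ℕ; zero; suc; _*_)
import Data.Nat as ℕ
open import Data.Integer using (+_)
open import Data.Rational as ℚ using (ℚ; 0ℚ; 1ℚ; _/_; _≤_; _<_; _-_; _+_)
open import Data.Fin using (Fin)
open import Data.Fin.Subset as Sub using (Subset; _∈_; _∉_; _⊆_; _∩_; Empty)
open import Data.Nat.ListAction using (sum)
open import Data.List using (List; []; _∷_; map; length; concatMap)
open import Data.List.Relation.Unary.All using (All)
open import Data.List.Relation.Unary.Unique.Propositional using (Unique)
open import Data.Vec using (lookup; tabulate)
open import Data.Product using (Σ; _×_; _,_; ∃)
open import Relation.Binary.PropositionalEquality using (_≡_)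

record Graph (n : ℕ) : Set where
  field
    adj     : Fin n → Fin n → Bool
    symm    : ∀ u v → adj u v ≡ adj v u
    irrefl  : ∀ v → adj v v ≡ false
open Graph public

ℕ→ℚ : ℕ → ℚ
ℕ→ℚ k = (+ k) / 1

∣_∣ᵣ : ∀ {n} → Subset n → ℚ
∣ X ∣ᵣ = ℕ→ℚ (Sub.∣ X ∣)

verts : (n : ℕ) → List (Fin n)
verts n = Data.List.allFin n

-- e(X,Y): number of pairs (x,y), x ∈ X, y ∈ Y, xy an edge
-- (for disjoint X, Y this is the number of edges between X and Y)
e : ∀ {n} → Graph n → Subset n → Subset n → ℕ
e {n} G X Y =
  sum (map (λ x → sum (map (λ y →
     if lookup X x ∧ lookup Y y ∧ adj G x y then 1 else 0) (verts n))) (verts n))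

-- d(X,Y) = e(X,Y)/(|X||Y|)  (set to 0 when X or Y is empty)
dens : ∀ {n} → Graph n → Subset n → Subset n → ℚ
dens G X Y with Sub.∣ X ∣ * Sub.∣ Y ∣
... | zero  = 0ℚ
... | suc m = (+ e G X Y) / suc m

Disjoint : ∀ {n} → Subset n → Subset n → Set
Disjoint X Y = Empty (X ∩ Y)

RegularPair : ∀ {n} → Graph n → ℚ → ℚ → Subset n → Subset n → Set
RegularPair G ε p V₁ V₂ =
  Disjoint V₁ V₂ ×
  (∀ (U₁ U₂ : Subset _) → U₁ ⊆ V₁ → U₂ ⊆ V₂ →
     ε ℚ.* ∣ V₁ ∣ᵣ ≤ ∣ U₁ ∣ᵣ → ε ℚ.* ∣ V₂ ∣ᵣ ≤ ∣ U₂ ∣ᵣ →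
     ℚ.∣ dens G V₁ V₂ - dens G U₁ U₂ ∣ ≤ ε ℚ.* p)

RegularTriple : ∀ {n} → Graph n → ℚ → ℚ → Subset n → Subset n → Subset n → Set
RegularTriple G ε p V₁ V₂ V₃ =
  RegularPair G ε p V₁ V₂ × RegularPair G ε p V₁ V₃ × RegularPair G ε p V₂ V₃

MinDensityAtLeast : ∀ {n} → Graph n → ℚ → Subset n → Subset n → Subset n → Set
MinDensityAtLeast G x V₁ V₂ V₃ =
  x ≤ dens G V₁ V₂ × x ≤ dens G V₁ V₃ × x ≤ dens G V₂ V₃

Nbhd : ∀ {n} → Graph n → Fin n → Subset n → Subset n
Nbhd G v W = tabulate (λ u → adj G v u ∧ lookup W u)

-- size condition (1-ε) d(V_i,V_l) |V_l| ≤ |N_l| ≤ (1+ε) d(V_i,V_l) |V_l|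
-- (here d(V_i,V_l) = d_il p)
NbhdSize : ∀ {n} → Graph n → ℚ → Fin n → Subset n → Subset n → Set
NbhdSize G ε v Vi Vl =
  (1ℚ - ε) ℚ.* dens G Vi Vl ℚ.* ∣ Vl ∣ᵣ ≤ ∣ Nbhd G v Vl ∣ᵣ ×
  ∣ Nbhd G v Vl ∣ᵣ ≤ (1ℚ + ε) ℚ.* dens G Vi Vl ℚ.* ∣ Vl ∣ᵣ

TypicalVertex : ∀ {n} → Graph n → ℚ → ℚ → Subset n → Subset n → Subset n → Fin n → Set
TypicalVertex G ε p Vi Vj Vk v =
  NbhdSize G ε v Vi Vj × NbhdSize G ε v Vi Vk ×
  Σ (Subset _) λ Nj' → Σ (Subset _) λ Nk' →
    Nj' ⊆ Nbhd G v Vj × Nk' ⊆ Nbhd G v Vk ×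
    (1ℚ - ε) ℚ.* ∣ Nbhd G v Vj ∣ᵣ ≤ ∣ Nj' ∣ᵣ ×
    (1ℚ - ε) ℚ.* ∣ Nbhd G v Vk ∣ᵣ ≤ ∣ Nk' ∣ᵣ ×
    RegularPair G ε p Nj' Nk' ×
    (1ℚ - ε) ℚ.* dens G Vj Vk ≤ dens G Nj' Nk' ×
    dens G Nj' Nk' ≤ (1ℚ + ε) ℚ.* dens G Vj Vk

MostlyTypical : ∀ {n} → Graph n → ℚ → ℚ → Subset n → Subset n → Subset n → Set
MostlyTypical G ε p Vi Vj Vk =
  Σ (Subset _) λ B → B ⊆ Vi × ∣ B ∣ᵣ ≤ ε ℚ.* ∣ Vi ∣ᵣ ×
    (∀ v → v ∈ Vi → v ∉ B → TypicalVertex G ε p Vi Vj Vk v)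

TypicalTriple : ∀ {n} → Graph n → ℚ → ℚ → Subset n → Subset n → Subset n → Set
TypicalTriple G ε p V₁ V₂ V₃ =
  RegularTriple G ε p V₁ V₂ V₃ ×
  MostlyTypical G ε p V₁ V₂ V₃ ×
  MostlyTypical G ε p V₂ V₁ V₃ ×
  MostlyTypical G ε p V₃ V₁ V₂

Triangle : ∀ {n} → Graph n → Subset n → Subset n → Subset n → Fin n × Fin n × Fin n → Set
Triangle G V₁ V₂ V₃ (x , y , z) =
  x ∈ V₁ × y ∈ V₂ × z ∈ V₃ ×
  adj G x y ≡ true × adj G y z ≡ true × adj G x z ≡ true

triVerts : ∀ {n} → List (Fin n × Fin n × Fin n) → List (Fin n)
triVerts = concatMap (λ { (x , y , z) → x ∷ y ∷ z ∷ [] })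

DisjointTriangles : ∀ {n} → Graph n → Subset n → Subset n → Subset n →
                    List (Fin n × Fin n × Fin n) → Set
DisjointTriangles G V₁ V₂ V₃ ts = All (Triangle G V₁ V₂ V₃) ts × Unique (triVerts ts)

-- Choose the triangles greedily.  As long as fewer than (1 − α) min |Vᵢ| are chosen, the unused part Wᵢ
-- of each class has more than α|Vᵢ| vertices.  By regularity of (V₁, Vₗ), fewer than ε|V₁| vertices of W₁
-- have few neighbours in Wₗ (together they would span too sparse a pair with Wₗ); as at most ε|V₁|
-- vertices are atypical and 3ε ≤ α, some typical v ∈ W₁ has many neighbours in both W₂ and W₃.  Then
-- N′ₗ ∩ Wₗ is an ε-fraction of N′ₗ, so the regular pair (N′₂, N′₃), whose density exceeds εp, has an
-- edge ab between these parts, and vab is a new triangle.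

module Submission where

open import Defs
open import Data.Nat using (ℕ)
open import Data.Rational using (ℚ; 0ℚ; 1ℚ; _≤_; _<_; _-_; _*_; _⊓_)
open import Data.Fin.Subset using (Subset)
open import Data.Fin using (Fin)
open import Data.List using (List; length)
open import Data.Product using (Σ; _×_)

open import Data.Bool using (Bool; true; false; _∧_; if_then_else_)
import Data.Bool.Properties as Bool
open import Data.Empty using (⊥; ⊥-elim)
open import Data.Fin using (zero; suc)
open import Data.Fin.Subset using (_∈_; _∉_; _⊆_; _∩_; _∪_; _─_; ⁅_⁆; ⋃; inside; outside)
  renaming (∣_∣ to #_)
open import Data.Fin.Subset.Properties
  using (x∈p∪q⁻; x∈p∪q⁺; x∈p∩q⁻; x∈p∩q⁺; p∩q⊆p; p∩q⊆q; p─q⊆p; p⊆q⇒∣p∣≤∣q∣; ∣p∣≤∣x∷p∣; ∣⁅x⁆∣≡1;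
         ∣⊥∣≡0; x∈⁅x⁆)
import Data.Integer as ℤ
open import Data.Integer using (+_)
import Data.Integer.Properties as ℤ
open import Data.List using ([]; _∷_; map; allFin)
import Data.List.Membership.Propositional as List
import Data.List.Membership.Propositional.Properties as List
import Data.List.Properties as List
open import Data.List.Relation.Unary.All using (All; []; _∷_)
open import Data.List.Relation.Unary.All.Properties using (¬Any⇒All¬)
open import Data.List.Relation.Unary.AllPairs using ([]; _∷_)
open import Data.List.Relation.Unary.Any using (here; there)
import Data.Nat as ℕ
import Data.Nat.Coprimality as Coprime
open import Data.Nat.ListAction as ListAction using ()
import Data.Nat.Properties as ℕ
open import Data.Product using (_,_; ∃; ∃₂; proj₁; proj₂)
import Data.Rational as ℚ
open import Data.Rational using (mkℚ)
import Data.Rational.Properties as ℚ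
open import Data.Rational.Solver using (module +-*-Solver)
open +-*-Solver using (solve; _:+_; _:*_; _:-_; _:=_; con)
import Data.Rational.Unnormalised as ℚᵘ
import Data.Rational.Unnormalised.Properties as ℚᵘ
open import Data.Sum using (_⊎_; inj₁; inj₂)
open import Data.Vec using ([]; _∷_; lookup; tabulate; here; there)
import Data.Vec.Properties as Vec
open import Function using (_∘_; id)
open import Relation.Binary.PropositionalEquality
open import Relation.Nullary using (Dec; yes; no; does)
open import Relation.Nullary.Decidable using (dec-true)

open import Algebra.Properties.Semiring.Sum ℕ.+-*-semiring
  using (sum-syntax; sum-cong-≗; sum-replicate-zero)

private
  variable
    n : ℕ
    p q r s : Subset n
    x u v : Fin n

-- Counting in finite sets

𝟙 : Bool → ℕ
𝟙 b = if b then 1 else 0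

∑-allFin : (f : Fin n → ℕ) → ListAction.sum (map f (allFin n)) ≡ ∑[ i < n ] f i
∑-allFin f = trans (cong ListAction.sum (List.map-tabulate id f)) (∑-tabulate f)
  where
  ∑-tabulate : ∀ {m} (g : Fin m → ℕ) → ListAction.sum (Data.List.tabulate g) ≡ ∑[ i < m ] g i
  ∑-tabulate {ℕ.zero}  g = refl
  ∑-tabulate {ℕ.suc m} g = cong (g zero ℕ.+_) (∑-tabulate (g ∘ suc))

∑-pos : (f : Fin n → ℕ) → 0 ℕ.< ∑[ i < n ] f i → ∃ λ i → 0 ℕ.< f i
∑-pos {ℕ.suc n} f pos with f zero in eq
... | ℕ.suc _ = zero , subst (0 ℕ.<_) (sym eq) (ℕ.s≤s ℕ.z≤n)
... | ℕ.zero  = let i , fi>0 = ∑-pos (f ∘ suc) pos in suc i , fi>0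

𝟙-pos : ∀ {b} → 0 ℕ.< 𝟙 b → b ≡ true
𝟙-pos {true} _ = refl

∧-true⁻ : ∀ {a b} → a ∧ b ≡ true → a ≡ true × b ≡ true
∧-true⁻ {true} {true} _ = refl , refl

lookup≡true⇒∈ : lookup p x ≡ true → x ∈ p
lookup≡true⇒∈ = Vec.lookup⇒[]= _ _

∈⇒lookup≡true : x ∈ p → lookup p x ≡ true
∈⇒lookup≡true = Vec.[]=⇒lookup

∈-tabulate⁻ : {f : Fin n → Bool} → x ∈ tabulate f → f x ≡ true
∈-tabulate⁻ {f = f} x∈ = trans (sym (Vec.lookup∘tabulate f _)) (∈⇒lookup≡true x∈)

∈-tabulate⁺ : {f : Fin n → Bool} → f x ≡ true → x ∈ tabulate f
∈-tabulate⁺ {f = f} fx = lookup≡true⇒∈ (trans (Vec.lookup∘tabulate f _) fx)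

does≡true⇒ : ∀ {A : Set} (a? : Dec A) → does a? ≡ true → A
does≡true⇒ (yes a) _ = a

select : {P : Fin n → Set} → (∀ x → Dec (P x)) → Subset n
select P? = tabulate (does ∘ P?)

∈-select⁻ : {P : Fin n → Set} (P? : ∀ x → Dec (P x)) → x ∈ select P? → P x
∈-select⁻ P? x∈ = does≡true⇒ (P? _) (∈-tabulate⁻ x∈)

∈-select⁺ : {P : Fin n → Set} (P? : ∀ x → Dec (P x)) → P x → x ∈ select P?
∈-select⁺ P? Px = ∈-tabulate⁺ (dec-true (P? _) Px)

∣p∣≡∑𝟙 : (p : Subset n) → # p ≡ ∑[ i < n ] 𝟙 (lookup p i)
∣p∣≡∑𝟙 []            = refl
∣p∣≡∑𝟙 (inside  ∷ p) = cong ℕ.suc (∣p∣≡∑𝟙 p)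
∣p∣≡∑𝟙 (outside ∷ p) = ∣p∣≡∑𝟙 p

∣tabulate∣≡∑𝟙 : (f : Fin n → Bool) → # tabulate f ≡ ∑[ i < n ] 𝟙 (f i)
∣tabulate∣≡∑𝟙 f = trans (∣p∣≡∑𝟙 (tabulate f)) (sum-cong-≗ (cong 𝟙 ∘ Vec.lookup∘tabulate f))

∣p∪q∣+∣p∩q∣≡∣p∣+∣q∣ : (p q : Subset n) → # (p ∪ q) ℕ.+ # (p ∩ q) ≡ # p ℕ.+ # q
∣p∪q∣+∣p∩q∣≡∣p∣+∣q∣ [] [] = refl
∣p∪q∣+∣p∩q∣≡∣p∣+∣q∣ (inside ∷ p) (inside ∷ q) =
  cong ℕ.suc (trans (ℕ.+-suc _ _) (trans (cong ℕ.suc (∣p∪q∣+∣p∩q∣≡∣p∣+∣q∣ p q)) (sym (ℕ.+-suc _ _))))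
∣p∪q∣+∣p∩q∣≡∣p∣+∣q∣ (inside ∷ p) (outside ∷ q) = cong ℕ.suc (∣p∪q∣+∣p∩q∣≡∣p∣+∣q∣ p q)
∣p∪q∣+∣p∩q∣≡∣p∣+∣q∣ (outside ∷ p) (inside ∷ q) =
  trans (cong ℕ.suc (∣p∪q∣+∣p∩q∣≡∣p∣+∣q∣ p q)) (sym (ℕ.+-suc _ _))
∣p∪q∣+∣p∩q∣≡∣p∣+∣q∣ (outside ∷ p) (outside ∷ q) = ∣p∪q∣+∣p∩q∣≡∣p∣+∣q∣ p q

∣p∪q∣≤∣p∣+∣q∣ : (p q : Subset n) → # (p ∪ q) ℕ.≤ # p ℕ.+ # q
∣p∪q∣≤∣p∣+∣q∣ p q = ℕ.≤-trans (ℕ.m≤m+n _ _) (ℕ.≤-reflexive (∣p∪q∣+∣p∩q∣≡∣p∣+∣q∣ p q))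

∪-⊆ : p ⊆ r → q ⊆ r → p ∪ q ⊆ r
∪-⊆ {p = p} {q = q} p⊆r q⊆r x∈ with x∈p∪q⁻ p q x∈
... | inj₁ x∈p = p⊆r x∈p
... | inj₂ x∈q = q⊆r x∈q

∣p∣+∣q∣≤∣r∣+∣s∣ : p ∪ q ⊆ r → p ∩ q ⊆ s → # p ℕ.+ # q ℕ.≤ # r ℕ.+ # s
∣p∣+∣q∣≤∣r∣+∣s∣ {p = p} {q} {r} {s} p∪q⊆r p∩q⊆s = begin
  # p ℕ.+ # q             ≡⟨ sym (∣p∪q∣+∣p∩q∣≡∣p∣+∣q∣ p q) ⟩
  # (p ∪ q) ℕ.+ # (p ∩ q) ≤⟨ ℕ.+-mono-≤ (p⊆q⇒∣p∣≤∣q∣ p∪q⊆r) (p⊆q⇒∣p∣≤∣q∣ p∩q⊆s) ⟩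
  # r ℕ.+ # s             ∎
  where open ℕ.≤-Reasoning

∣p∣≤∣p─q∣+∣q∣ : (p q : Subset n) → # p ℕ.≤ # (p ─ q) ℕ.+ # q
∣p∣≤∣p─q∣+∣q∣ []            []            = ℕ.z≤n
∣p∣≤∣p─q∣+∣q∣ (inside  ∷ p) (inside  ∷ q) =
  ℕ.≤-trans (ℕ.s≤s (∣p∣≤∣p─q∣+∣q∣ p q)) (ℕ.≤-reflexive (sym (ℕ.+-suc _ _)))
∣p∣≤∣p─q∣+∣q∣ (inside  ∷ p) (outside ∷ q) = ℕ.s≤s (∣p∣≤∣p─q∣+∣q∣ p q)
∣p∣≤∣p─q∣+∣q∣ (outside ∷ p) (inside  ∷ q) =
  ℕ.≤-trans (∣p∣≤∣p─q∣+∣q∣ p q) (ℕ.+-monoʳ-≤ _ (ℕ.n≤1+n _))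
∣p∣≤∣p─q∣+∣q∣ (outside ∷ p) (outside ∷ q) = ∣p∣≤∣p─q∣+∣q∣ p q

x∈p─q⇒x∉q : (p q : Subset n) → x ∈ p ─ q → x ∉ q
x∈p─q⇒x∉q (inside ∷ p) (outside ∷ q) here          ()
x∈p─q⇒x∉q (_      ∷ p) (_       ∷ q) (there x∈p─q) (there x∈q) = x∈p─q⇒x∉q p q x∈p─q x∈q

∃∈∉-there : ∀ {a b} {p q : Subset n} → ∃ (λ x → x ∈ p × x ∉ q) →
            ∃ λ x → x ∈ (a ∷ p) × x ∉ (b ∷ q)
∃∈∉-there (x , x∈p , x∉q) = suc x , there x∈p , λ { (there x∈q) → x∉q x∈q }

∣q∣<∣p∣⇒∃∈p∉q : (p q : Subset n) → # q ℕ.< # p → ∃ λ x → x ∈ p × x ∉ q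
∣q∣<∣p∣⇒∃∈p∉q (inside  ∷ p) (outside ∷ q) _ = zero , here , λ ()
∣q∣<∣p∣⇒∃∈p∉q (inside  ∷ p) (inside  ∷ q) (ℕ.s≤s q<p) =
  ∃∈∉-there (∣q∣<∣p∣⇒∃∈p∉q p q q<p)
∣q∣<∣p∣⇒∃∈p∉q (outside ∷ p) (b       ∷ q) q<p =
  ∃∈∉-there (∣q∣<∣p∣⇒∃∈p∉q p q (ℕ.≤-<-trans (∣p∣≤∣x∷p∣ b q) q<p))

fromList : List (Fin n) → Subset n
fromList xs = ⋃ (map ⁅_⁆ xs)

∣fromList∣≤length : (xs : List (Fin n)) → # fromList xs ℕ.≤ length xs
∣fromList∣≤length {n} []       = ℕ.≤-reflexive (∣⊥∣≡0 n)
∣fromList∣≤length      (x ∷ xs) = begin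
  # (⁅ x ⁆ ∪ fromList xs)      ≤⟨ ∣p∪q∣≤∣p∣+∣q∣ ⁅ x ⁆ (fromList xs) ⟩
  # ⁅ x ⁆ ℕ.+ # fromList xs    ≡⟨ cong (ℕ._+ # fromList xs) (∣⁅x⁆∣≡1 x) ⟩
  ℕ.suc (# fromList xs)        ≤⟨ ℕ.s≤s (∣fromList∣≤length xs) ⟩
  ℕ.suc (length xs)            ∎
  where open ℕ.≤-Reasoning

∈-Nbhd⁻ : (G : Graph n) → u ∈ Nbhd G v p → adj G v u ≡ true × u ∈ p
∈-Nbhd⁻ G u∈ = let vu , pu = ∧-true⁻ (∈-tabulate⁻ u∈) in vu , lookup≡true⇒∈ pu

∈-Nbhd⁺ : (G : Graph n) → adj G v u ≡ true → u ∈ p → u ∈ Nbhd G v p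
∈-Nbhd⁺ G vu u∈p = ∈-tabulate⁺ (cong₂ _∧_ vu (∈⇒lookup≡true u∈p))

Nbhd-mono : (G : Graph n) → p ⊆ q → Nbhd G v p ⊆ Nbhd G v q
Nbhd-mono G p⊆q u∈ = let vu , u∈p = ∈-Nbhd⁻ G u∈ in ∈-Nbhd⁺ G vu (p⊆q u∈p)

e≡∑∑ : (G : Graph n) (X Y : Subset n) →
       e G X Y ≡ ∑[ x < n ] ∑[ y < n ] 𝟙 (lookup X x ∧ lookup Y y ∧ adj G x y)
e≡∑∑ G X Y = trans (∑-allFin (λ x → ListAction.sum (map (entry x) (allFin _))))
                    (sum-cong-≗ (λ x → ∑-allFin (entry x)))
  where
  entry : Fin _ → Fin _ → ℕ
  entry x y = 𝟙 (lookup X x ∧ lookup Y y ∧ adj G x y)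

e≡∑∣Nbhd∣ : (G : Graph n) (X Y : Subset n) →
            e G X Y ≡ ∑[ x < n ] (𝟙 (lookup X x) ℕ.* # Nbhd G x Y)
e≡∑∣Nbhd∣ {n} G X Y = trans (e≡∑∑ G X Y) (sum-cong-≗ row)
  where
  row : ∀ x → ∑[ y < n ] 𝟙 (lookup X x ∧ lookup Y y ∧ adj G x y) ≡ 𝟙 (lookup X x) ℕ.* # Nbhd G x Y
  row x with lookup X x
  ... | false = sum-replicate-zero n
  ... | true  = begin
    ∑[ y < n ] 𝟙 (lookup Y y ∧ adj G x y) ≡⟨ sum-cong-≗ (λ y → cong 𝟙 (Bool.∧-comm (lookup Y y) _)) ⟩
    ∑[ y < n ] 𝟙 (adj G x y ∧ lookup Y y) ≡⟨ ∣tabulate∣≡∑𝟙 (λ y → adj G x y ∧ lookup Y y) ⟨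
    # Nbhd G x Y                          ≡⟨ ℕ.+-identityʳ (# Nbhd G x Y) ⟨
    1 ℕ.* # Nbhd G x Y                    ∎
    where open ≡-Reasoning

e>0⇒edge : (G : Graph n) (X Y : Subset n) → 0 ℕ.< e G X Y →
           ∃₂ λ x y → x ∈ X × y ∈ Y × adj G x y ≡ true
e>0⇒edge G X Y e>0 with ∑-pos _ (subst (0 ℕ.<_) (e≡∑∑ G X Y) e>0)
... | x , row>0 with ∑-pos _ row>0
... | y , xy>0 with ∧-true⁻ (𝟙-pos xy>0)
... | Xx , Yy∧xy with ∧-true⁻ Yy∧xy
... | Yy , xy = x , y , lookup≡true⇒∈ Xx , lookup≡true⇒∈ Yy , xy

-- Rational arithmetic

ℕ→ℚ≡mkℚ : ∀ k → ℕ→ℚ k ≡ mkℚ (+ k) 0 (Coprime.sym (Coprime.1-coprimeTo k))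
ℕ→ℚ≡mkℚ k = ℚ.normalize-coprime (Coprime.sym (Coprime.1-coprimeTo k))

private
  k*1≡k : ∀ k → + k ℤ.* + 1 ≡ + k
  k*1≡k k = ℤ.*-identityʳ (+ k)

ℕ→ℚ-+ : ∀ a b → ℕ→ℚ (a ℕ.+ b) ≡ ℕ→ℚ a ℚ.+ ℕ→ℚ b
ℕ→ℚ-+ a b rewrite ℕ→ℚ≡mkℚ a | ℕ→ℚ≡mkℚ b =
  ℚ./-cong (trans (ℤ.pos-+ a b) (sym (cong₂ ℤ._+_ (k*1≡k a) (k*1≡k b)))) refl

ℕ→ℚ-* : ∀ a b → ℕ→ℚ (a ℕ.* b) ≡ ℕ→ℚ a * ℕ→ℚ b
ℕ→ℚ-* a b rewrite ℕ→ℚ≡mkℚ a | ℕ→ℚ≡mkℚ b = ℚ./-cong (ℤ.pos-* a b) refl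

ℕ→ℚ-mono-≤ : ∀ {a b} → a ℕ.≤ b → ℕ→ℚ a ≤ ℕ→ℚ b
ℕ→ℚ-mono-≤ {a} {b} a≤b rewrite ℕ→ℚ≡mkℚ a | ℕ→ℚ≡mkℚ b =
  ℚ.*≤* (subst₂ ℤ._≤_ (sym (k*1≡k a)) (sym (k*1≡k b)) (ℤ.+≤+ a≤b))

ℕ→ℚ-cancel-< : ∀ {a b} → ℕ→ℚ a < ℕ→ℚ b → a ℕ.< b
ℕ→ℚ-cancel-< {a} {b} a<b rewrite ℕ→ℚ≡mkℚ a | ℕ→ℚ≡mkℚ b with a<b
... | ℚ.*<* a<b′ = ℤ.drop‿+<+ (subst₂ ℤ._<_ (k*1≡k a) (k*1≡k b) a<b′)

ℕ→ℚ-nonNeg : ∀ a → 0ℚ ≤ ℕ→ℚ a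
ℕ→ℚ-nonNeg a = ℕ→ℚ-mono-≤ {0} {a} ℕ.z≤n

∣p∣ᵣ-nonNeg : (p : Subset n) → 0ℚ ≤ ∣ p ∣ᵣ
∣p∣ᵣ-nonNeg p = ℕ→ℚ-nonNeg (# p)

*-monoˡ-≤-nonNeg : ∀ {r a b} → 0ℚ ≤ r → a ≤ b → r * a ≤ r * b
*-monoˡ-≤-nonNeg {r} 0≤r = ℚ.*-monoˡ-≤-nonNeg r {{ℚ.nonNegative 0≤r}}

*-monoʳ-≤-nonNeg : ∀ {r a b} → 0ℚ ≤ r → a ≤ b → a * r ≤ b * r
*-monoʳ-≤-nonNeg {r} 0≤r = ℚ.*-monoʳ-≤-nonNeg r {{ℚ.nonNegative 0≤r}}

*-monoˡ-<-pos : ∀ {r a b} → 0ℚ < r → a < b → r * a < r * b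
*-monoˡ-<-pos {r} 0<r = ℚ.*-monoʳ-<-pos r {{ℚ.positive 0<r}}

*-cancelˡ-≤-pos : ∀ {r a b} → 0ℚ < r → r * a ≤ r * b → a ≤ b
*-cancelˡ-≤-pos {r} 0<r = ℚ.*-cancelˡ-≤-pos r {{ℚ.positive 0<r}}

*-nonNeg : ∀ {a b} → 0ℚ ≤ a → 0ℚ ≤ b → 0ℚ ≤ a * b
*-nonNeg {a} {b} 0≤a 0≤b = subst (_≤ a * b) (ℚ.*-zeroʳ a) (*-monoˡ-≤-nonNeg 0≤a 0≤b)

*-pos : ∀ {a b} → 0ℚ < a → 0ℚ < b → 0ℚ < a * b
*-pos {a} {b} 0<a 0<b = subst (_< a * b) (ℚ.*-zeroʳ a) (*-monoˡ-<-pos 0<a 0<b)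

⊓-pos : ∀ {a b} → 0ℚ < a → 0ℚ < b → 0ℚ < a ⊓ b
⊓-pos {a} {b} a>0 b>0 with ℚ.⊓-sel a b
... | inj₁ a⊓b≡a = subst (0ℚ <_) (sym a⊓b≡a) a>0
... | inj₂ a⊓b≡b = subst (0ℚ <_) (sym a⊓b≡b) b>0

+-cancelʳ-≤ : ∀ {a b} c → a ℚ.+ c ≤ b ℚ.+ c → a ≤ b
+-cancelʳ-≤ {a} {b} c a+c≤b+c = begin
  a                    ≡⟨ solve 2 (λ a c → a := (a :+ c) :- c) refl a c ⟩
  (a ℚ.+ c) - c        ≤⟨ ℚ.+-monoˡ-≤ (ℚ.- c) a+c≤b+c ⟩
  (b ℚ.+ c) - c        ≡⟨ solve 2 (λ b c → (b :+ c) :- c := b) refl b c ⟩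
  b                    ∎
  where open ℚ.≤-Reasoning

+-cancelʳ-< : ∀ {a b} c → a ℚ.+ c < b ℚ.+ c → a < b
+-cancelʳ-< {a} {b} c a+c<b+c = begin-strict
  a                    ≡⟨ solve 2 (λ a c → a := (a :+ c) :- c) refl a c ⟩
  (a ℚ.+ c) - c        <⟨ ℚ.+-monoˡ-< (ℚ.- c) a+c<b+c ⟩
  (b ℚ.+ c) - c        ≡⟨ solve 2 (λ b c → (b :+ c) :- c := b) refl b c ⟩
  b                    ∎
  where open ℚ.≤-Reasoning

≤⇒0≤- : ∀ {a b} → a ≤ b → 0ℚ ≤ b - a
≤⇒0≤- {a} {b} a≤b = +-cancelʳ-≤ a (subst₂ _≤_ (sym (ℚ.+-identityˡ a))
  (solve 2 (λ a b → b := (b :- a) :+ a) refl a b) a≤b)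

p≤∣p∣ : ∀ a → a ≤ ℚ.∣ a ∣
p≤∣p∣ a with ℚ.≤-total 0ℚ a
... | inj₁ 0≤a = ℚ.≤-reflexive (sym (ℚ.0≤p⇒∣p∣≡p 0≤a))
... | inj₂ a≤0 = ℚ.≤-trans a≤0 (ℚ.0≤∣p∣ a)

∣x-y∣≤c⇒x≤y+c : ∀ {x y c} → ℚ.∣ x - y ∣ ≤ c → x ≤ y ℚ.+ c
∣x-y∣≤c⇒x≤y+c {x} {y} {c} ∣x-y∣≤c = begin
  x                    ≡⟨ solve 2 (λ x y → x := y :+ (x :- y)) refl x y ⟩
  y ℚ.+ (x - y)        ≤⟨ ℚ.+-monoʳ-≤ y (ℚ.≤-trans (p≤∣p∣ (x - y)) ∣x-y∣≤c) ⟩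
  y ℚ.+ c              ∎
  where open ℚ.≤-Reasoning

/-*-cancel : ∀ a m → (+ a ℚ./ ℕ.suc m) * ℕ→ℚ (ℕ.suc m) ≡ ℕ→ℚ a
/-*-cancel a m = ℚ.toℚᵘ-injective (ℚᵘ.≃-trans (ℚ.toℚᵘ-homo-* (+ a ℚ./ ℕ.suc m) (ℕ→ℚ (ℕ.suc m)))
  (ℚᵘ.≃-trans (ℚᵘ.*-cong (ℚ.toℚᵘ-fromℚᵘ (ℚᵘ.mkℚᵘ (+ a) m)) (ℚ.toℚᵘ-fromℚᵘ (ℚᵘ.mkℚᵘ (+ ℕ.suc m) 0)))
  (ℚᵘ.≃-trans (ℚᵘ.*≡* cross) (ℚᵘ.≃-sym (ℚ.toℚᵘ-fromℚᵘ (ℚᵘ.mkℚᵘ (+ a) 0))))))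
  where
  cross : (+ a ℤ.* + ℕ.suc m) ℤ.* + 1 ≡ + a ℤ.* (+ ℕ.suc (m ℕ.* 1))
  cross rewrite ℕ.*-identityʳ m = ℤ.*-identityʳ _

-- Densities

dens*∣X∣∣Y∣≡e : (G : Graph n) (X Y : Subset n) → 0 ℕ.< # X ℕ.* # Y →
                dens G X Y * ℕ→ℚ (# X ℕ.* # Y) ≡ ℕ→ℚ (e G X Y)
dens*∣X∣∣Y∣≡e G X Y _ with # X ℕ.* # Y
... | ℕ.suc m = /-*-cancel (e G X Y) m

e≡0⇒dens≡0 : (G : Graph n) (X Y : Subset n) → e G X Y ≡ 0 → dens G X Y ≡ 0ℚ
e≡0⇒dens≡0 G X Y e≡0 with # X ℕ.* # Y
... | ℕ.zero  = refl
... | ℕ.suc m rewrite e≡0 = ℚ.0/n≡0 (ℕ.suc m)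

dens>0⇒e>0 : (G : Graph n) (X Y : Subset n) → 0ℚ < dens G X Y → 0 ℕ.< e G X Y
dens>0⇒e>0 G X Y d>0 = ℕ.n≢0⇒n>0 λ e≡0 → ℚ.<-irrefl (sym (e≡0⇒dens≡0 G X Y e≡0)) d>0

∑𝟙*≤∑𝟙*K : (b : Fin n → Bool) (f : Fin n → ℕ) {K : ℚ} → (∀ i → b i ≡ true → ℕ→ℚ (f i) ≤ K) →
           ℕ→ℚ (∑[ i < n ] (𝟙 (b i) ℕ.* f i)) ≤ ℕ→ℚ (∑[ i < n ] 𝟙 (b i)) * K
∑𝟙*≤∑𝟙*K {ℕ.zero}  b f {K} _   = ℚ.≤-reflexive (sym (ℚ.*-zeroˡ K))
∑𝟙*≤∑𝟙*K {ℕ.suc n} b f {K} f≤K = begin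
  ℕ→ℚ (𝟙 (b zero) ℕ.* f zero ℕ.+ rest)       ≡⟨ ℕ→ℚ-+ (𝟙 (b zero) ℕ.* f zero) rest ⟩
  ℕ→ℚ (𝟙 (b zero) ℕ.* f zero) ℚ.+ ℕ→ℚ rest   ≤⟨ ℚ.+-mono-≤ (head (b zero) refl)
                                                   (∑𝟙*≤∑𝟙*K (b ∘ suc) (f ∘ suc) (f≤K ∘ suc)) ⟩
  ℕ→ℚ (𝟙 (b zero)) * K ℚ.+ ℕ→ℚ count * K     ≡⟨ ℚ.*-distribʳ-+ K (ℕ→ℚ (𝟙 (b zero))) (ℕ→ℚ count) ⟨
  (ℕ→ℚ (𝟙 (b zero)) ℚ.+ ℕ→ℚ count) * K       ≡⟨ cong (_* K) (ℕ→ℚ-+ (𝟙 (b zero)) count) ⟨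
  ℕ→ℚ (𝟙 (b zero) ℕ.+ count) * K             ∎
  where
  open ℚ.≤-Reasoning
  rest count : ℕ
  rest  = ∑[ i < n ] (𝟙 (b (suc i)) ℕ.* f (suc i))
  count = ∑[ i < n ] 𝟙 (b (suc i))
  head : ∀ c → b zero ≡ c → ℕ→ℚ (𝟙 c ℕ.* f zero) ≤ ℕ→ℚ (𝟙 c) * K
  head true  b₀ = subst₂ _≤_ (cong ℕ→ℚ (sym (ℕ.+-identityʳ (f zero)))) (sym (ℚ.*-identityˡ K)) (f≤K zero b₀)
  head false _  = ℚ.≤-reflexive (sym (ℚ.*-zeroˡ K))

dens*∣Y∣≤K : (G : Graph n) {X Y : Subset n} {K : ℚ} → 0ℚ < ∣ X ∣ᵣ → 0ℚ < ∣ Y ∣ᵣ →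
             (∀ x → x ∈ X → ∣ Nbhd G x Y ∣ᵣ ≤ K) → dens G X Y * ∣ Y ∣ᵣ ≤ K
dens*∣Y∣≤K {n} G {X} {Y} {K} X>0 Y>0 deg≤K = *-cancelˡ-≤-pos X>0 (begin
  ∣ X ∣ᵣ * (dens G X Y * ∣ Y ∣ᵣ)       ≡⟨ solve 3 (λ x d y → x :* (d :* y) := d :* (x :* y)) refl
                                            ∣ X ∣ᵣ (dens G X Y) ∣ Y ∣ᵣ ⟩
  dens G X Y * (∣ X ∣ᵣ * ∣ Y ∣ᵣ)       ≡⟨ cong (dens G X Y *_) (ℕ→ℚ-* (# X) (# Y)) ⟨
  dens G X Y * ℕ→ℚ (# X ℕ.* # Y)       ≡⟨ dens*∣X∣∣Y∣≡e G X Y ∣X∣∣Y∣>0 ⟩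
  ℕ→ℚ (e G X Y)                        ≡⟨ cong ℕ→ℚ (e≡∑∣Nbhd∣ G X Y) ⟩
  ℕ→ℚ (∑[ x < n ] (𝟙 (lookup X x) ℕ.* # Nbhd G x Y))
    ≤⟨ ∑𝟙*≤∑𝟙*K (lookup X) (λ x → # Nbhd G x Y) (λ x Xx → deg≤K x (lookup≡true⇒∈ Xx)) ⟩
  ℕ→ℚ (∑[ x < n ] 𝟙 (lookup X x)) * K ≡⟨ cong (λ k → ℕ→ℚ k * K) (∣p∣≡∑𝟙 X) ⟨
  ∣ X ∣ᵣ * K                           ∎)
  where
  open ℚ.≤-Reasoning
  positive-product : ∀ {a b} → 0 ℕ.< a → 0 ℕ.< b → 0 ℕ.< a ℕ.* b
  positive-product {ℕ.suc _} {ℕ.suc _} _ _ = ℕ.s≤s ℕ.z≤n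
  ∣X∣∣Y∣>0 : 0 ℕ.< # X ℕ.* # Y
  ∣X∣∣Y∣>0 = positive-product (ℕ→ℚ-cancel-< {0} {# X} X>0) (ℕ→ℚ-cancel-< {0} {# Y} Y>0)

regular-pair-edge : (G : Graph n) {ε p : ℚ} {X Y A B : Subset n} → RegularPair G ε p X Y →
                    ε * p < dens G X Y → A ⊆ X → B ⊆ Y → ε * ∣ X ∣ᵣ ≤ ∣ A ∣ᵣ → ε * ∣ Y ∣ᵣ ≤ ∣ B ∣ᵣ →
                    ∃₂ λ a b → a ∈ A × b ∈ B × adj G a b ≡ true
regular-pair-edge G {ε} {p} {X} {Y} {A} {B} (_ , reg) εp<d A⊆X B⊆Y A-large B-large =
  e>0⇒edge G A B (dens>0⇒e>0 G A B (+-cancelʳ-< (ε * p) (begin-strict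
    0ℚ ℚ.+ ε * p          ≡⟨ ℚ.+-identityˡ (ε * p) ⟩
    ε * p                 <⟨ εp<d ⟩
    dens G X Y            ≤⟨ ∣x-y∣≤c⇒x≤y+c (reg A B A⊆X B⊆Y A-large B-large) ⟩
    dens G A B ℚ.+ ε * p  ∎)))
  where open ℚ.≤-Reasoning

survivors : ∀ {ε M a n n′ b} → 0ℚ ≤ ε → ℕ→ℚ 2 * ε * M ≤ a → n ≤ M → (1ℚ - ε) * n ≤ n′ → n′ ≤ n →
            a ℚ.+ n′ ≤ n ℚ.+ b → ε * n′ ≤ b
survivors {ε} {M} {a} {n} {n′} {b} ε≥0 2εM≤a n≤M n′-large n′≤n a+n′≤n+b =
  ℚ.≤-trans (*-monoˡ-≤-nonNeg ε≥0 n′≤n) (+-cancelʳ-≤ n (begin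
    ε * n ℚ.+ n                      ≡⟨ solve 2 (λ e n → e :* n :+ n
                                          := con (ℕ→ℚ 2) :* e :* n :+ (con 1ℚ :- e) :* n) refl ε n ⟩
    ℕ→ℚ 2 * ε * n ℚ.+ (1ℚ - ε) * n  ≤⟨ ℚ.+-mono-≤ (ℚ.≤-trans (*-monoˡ-≤-nonNeg 2ε≥0 n≤M) 2εM≤a) n′-large ⟩
    a ℚ.+ n′                         ≤⟨ a+n′≤n+b ⟩
    n ℚ.+ b                          ≡⟨ ℚ.+-comm n b ⟩
    b ℚ.+ n                          ∎))
  where
  open ℚ.≤-Reasoning
  2ε≥0 : 0ℚ ≤ ℕ→ℚ 2 * ε
  2ε≥0 = *-nonNeg (ℕ→ℚ-nonNeg 2) ε≥0

remaining-large : ∀ {α k m N w} → 0ℚ ≤ k → k < (1ℚ - α) * m → 0ℚ ≤ m → m ≤ N → N ≤ w ℚ.+ k →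
                  α * N < w
remaining-large {α} {k} {m} {N} {w} k≥0 k<[1-α]m m≥0 m≤N N≤w+k with ℚ.≤-total 0ℚ (1ℚ - α)
... | inj₂ 1-α≤0 = ⊥-elim (ℚ.<-irrefl refl (ℚ.≤-<-trans k≥0 (ℚ.<-≤-trans k<[1-α]m
      (ℚ.≤-trans (*-monoʳ-≤-nonNeg m≥0 1-α≤0) (ℚ.≤-reflexive (ℚ.*-zeroˡ m))))))
... | inj₁ 1-α≥0 = +-cancelʳ-< ((1ℚ - α) * N) (begin-strict
    α * N ℚ.+ (1ℚ - α) * N           ≡⟨ solve 2 (λ a N → a :* N :+ (con 1ℚ :- a) :* N := N) refl α N ⟩
    N                                ≤⟨ N≤w+k ⟩
    w ℚ.+ k                          <⟨ ℚ.+-monoʳ-< w (ℚ.<-≤-trans k<[1-α]m (*-monoˡ-≤-nonNeg 1-α≥0 m≤N)) ⟩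
    w ℚ.+ (1ℚ - α) * N               ∎)
  where open ℚ.≤-Reasoning

neighbourhood-survives : (G : Graph n) {ε M : ℚ} {U W N′ : Subset n} → 0ℚ ≤ ε → W ⊆ U →
                         N′ ⊆ Nbhd G v U → (1ℚ - ε) * ∣ Nbhd G v U ∣ᵣ ≤ ∣ N′ ∣ᵣ → ∣ Nbhd G v U ∣ᵣ ≤ M →
                         ℕ→ℚ 2 * ε * M ≤ ∣ Nbhd G v W ∣ᵣ → ε * ∣ N′ ∣ᵣ ≤ ∣ N′ ∩ W ∣ᵣ
neighbourhood-survives {v = v} G {U = U} {W} {N′} ε≥0 W⊆U N′⊆N N′-large N≤M many-in-W =
  survivors ε≥0 many-in-W N≤M N′-large (ℕ→ℚ-mono-≤ (p⊆q⇒∣p∣≤∣q∣ N′⊆N)) (begin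
    ∣ Nbhd G v W ∣ᵣ ℚ.+ ∣ N′ ∣ᵣ          ≡⟨ ℕ→ℚ-+ (# Nbhd G v W) (# N′) ⟨
    ℕ→ℚ (# Nbhd G v W ℕ.+ # N′)          ≤⟨ ℕ→ℚ-mono-≤ (∣p∣+∣q∣≤∣r∣+∣s∣ (∪-⊆ (Nbhd-mono G W⊆U) N′⊆N) inW) ⟩
    ℕ→ℚ (# Nbhd G v U ℕ.+ # (N′ ∩ W))    ≡⟨ ℕ→ℚ-+ (# Nbhd G v U) (# (N′ ∩ W)) ⟩
    ∣ Nbhd G v U ∣ᵣ ℚ.+ ∣ N′ ∩ W ∣ᵣ      ∎)
  where
  open ℚ.≤-Reasoning
  inW : Nbhd G v W ∩ N′ ⊆ N′ ∩ W
  inW x∈ = let x∈NW , x∈N′ = x∈p∩q⁻ _ _ x∈ in x∈p∩q⁺ (x∈N′ , proj₂ (∈-Nbhd⁻ G x∈NW))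

record Small (α δ ε : ℚ) : Set where
  field
    ε>0   : 0ℚ < ε
    16ε≤α : ℕ→ℚ 16 * ε ≤ α
    4ε≤δ  : ℕ→ℚ 4 * ε ≤ δ
    2ε≤1  : ℕ→ℚ 2 * ε ≤ 1ℚ

  ε≥0 : 0ℚ ≤ ε
  ε≥0 = ℚ.<⇒≤ ε>0

  ε≤kε : ∀ {k} → 1 ℕ.≤ k → ε ≤ ℕ→ℚ k * ε
  ε≤kε 1≤k = ℚ.≤-trans (ℚ.≤-reflexive (sym (ℚ.*-identityˡ ε))) (*-monoʳ-≤-nonNeg ε≥0 (ℕ→ℚ-mono-≤ 1≤k))

  ε≤α : ε ≤ α
  ε≤α = ℚ.≤-trans (ε≤kε {16} (ℕ.s≤s ℕ.z≤n)) 16ε≤α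

  ε≤δ : ε ≤ δ
  ε≤δ = ℚ.≤-trans (ε≤kε {4} (ℕ.s≤s ℕ.z≤n)) 4ε≤δ

  α>0 : 0ℚ < α
  α>0 = ℚ.<-≤-trans ε>0 ε≤α

  -- εp ≤ D/4 gives 3D ≤ 4d, and then 3Dw ≤ 4dw ≤ 16εDN ≤ αDN < Dw.
  low-degree-absurd : ∀ {p D d w N} → 0ℚ < p → δ * p ≤ D → D ≤ d ℚ.+ ε * p →
                      d * w ≤ ℕ→ℚ 2 * ε * ((1ℚ ℚ.+ ε) * D * N) → α * N < w → 0ℚ ≤ N → ⊥
  low-degree-absurd {p} {D} {d} {w} {N} p>0 δp≤D D≤d+εp dw≤T αN<w N≥0 = ℚ.<-irrefl refl (begin-strict
    D * w                                       ≤⟨ Dw≤3Dw ⟩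
    ℕ→ℚ 3 * D * w                              ≤⟨ *-monoʳ-≤-nonNeg w≥0 3D≤4d ⟩
    ℕ→ℚ 4 * d * w                              ≡⟨ ℚ.*-assoc (ℕ→ℚ 4) d w ⟩
    ℕ→ℚ 4 * (d * w)                            ≤⟨ *-monoˡ-≤-nonNeg (ℕ→ℚ-nonNeg 4) dw≤T ⟩
    ℕ→ℚ 4 * (ℕ→ℚ 2 * ε * ((1ℚ ℚ.+ ε) * D * N)) ≡⟨ solve 4 (λ e D N x →
        con (ℕ→ℚ 4) :* (con (ℕ→ℚ 2) :* e :* (x :* D :* N)) := con (ℕ→ℚ 8) :* e :* D :* N :* x)
        refl ε D N (1ℚ ℚ.+ ε) ⟩
    ℕ→ℚ 8 * ε * D * N * (1ℚ ℚ.+ ε)             ≤⟨ *-monoˡ-≤-nonNeg 8εDN≥0 1+ε≤2 ⟩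
    ℕ→ℚ 8 * ε * D * N * ℕ→ℚ 2                  ≡⟨ solve 3 (λ e D N →
        con (ℕ→ℚ 8) :* e :* D :* N :* con (ℕ→ℚ 2) := con (ℕ→ℚ 16) :* e :* (D :* N)) refl ε D N ⟩
    ℕ→ℚ 16 * ε * (D * N)                       ≤⟨ *-monoʳ-≤-nonNeg DN≥0 16ε≤α ⟩
    α * (D * N)                                 ≡⟨ solve 3 (λ a D N → a :* (D :* N) := D :* (a :* N)) refl α D N ⟩
    D * (α * N)                                 <⟨ *-monoˡ-<-pos D>0 αN<w ⟩
    D * w                                       ∎)
    where
    open ℚ.≤-Reasoning
    D>0 : 0ℚ < D
    D>0 = ℚ.<-≤-trans (*-pos (ℚ.<-≤-trans ε>0 ε≤δ) p>0) δp≤D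
    D≥0 : 0ℚ ≤ D
    D≥0 = ℚ.<⇒≤ D>0
    w≥0 : 0ℚ ≤ w
    w≥0 = ℚ.<⇒≤ (ℚ.≤-<-trans (*-nonNeg (ℚ.<⇒≤ α>0) N≥0) αN<w)
    DN≥0 : 0ℚ ≤ D * N
    DN≥0 = *-nonNeg D≥0 N≥0
    8εDN≥0 : 0ℚ ≤ ℕ→ℚ 8 * ε * D * N
    8εDN≥0 = *-nonNeg (*-nonNeg (*-nonNeg (ℕ→ℚ-nonNeg 8) ε≥0) D≥0) N≥0
    Dw≤3Dw : D * w ≤ ℕ→ℚ 3 * D * w
    Dw≤3Dw = begin
      D * w                          ≡⟨ ℚ.+-identityʳ (D * w) ⟨
      D * w ℚ.+ 0ℚ                   ≤⟨ ℚ.+-monoʳ-≤ (D * w) (*-nonNeg (*-nonNeg (ℕ→ℚ-nonNeg 2) D≥0) w≥0) ⟩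
      D * w ℚ.+ ℕ→ℚ 2 * D * w       ≡⟨ solve 2 (λ D w → D :* w :+ con (ℕ→ℚ 2) :* D :* w := con (ℕ→ℚ 3) :* D :* w)
                                          refl D w ⟩
      ℕ→ℚ 3 * D * w                 ∎
    3D≤4d : ℕ→ℚ 3 * D ≤ ℕ→ℚ 4 * d
    3D≤4d = +-cancelʳ-≤ D (begin
      ℕ→ℚ 3 * D ℚ.+ D               ≡⟨ solve 1 (λ D → con (ℕ→ℚ 3) :* D :+ D := con (ℕ→ℚ 4) :* D) refl D ⟩
      ℕ→ℚ 4 * D                     ≤⟨ *-monoˡ-≤-nonNeg (ℕ→ℚ-nonNeg 4) D≤d+εp ⟩
      ℕ→ℚ 4 * (d ℚ.+ ε * p)         ≡⟨ solve 3 (λ d e p → con (ℕ→ℚ 4) :* (d :+ e :* p)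
                                          := con (ℕ→ℚ 4) :* d :+ con (ℕ→ℚ 4) :* e :* p) refl d ε p ⟩
      ℕ→ℚ 4 * d ℚ.+ ℕ→ℚ 4 * ε * p  ≤⟨ ℚ.+-monoʳ-≤ (ℕ→ℚ 4 * d)
                                          (ℚ.≤-trans (*-monoʳ-≤-nonNeg (ℚ.<⇒≤ p>0) 4ε≤δ) δp≤D) ⟩
      ℕ→ℚ 4 * d ℚ.+ D               ∎)
    1+ε≤2 : 1ℚ ℚ.+ ε ≤ ℕ→ℚ 2
    1+ε≤2 = ℚ.+-monoʳ-≤ 1ℚ (ℚ.≤-trans (ε≤kε {2} (ℕ.s≤s ℕ.z≤n)) 2ε≤1)

  εp<[1-ε]D : ∀ {p D} → 0ℚ < p → δ * p ≤ D → ε * p < (1ℚ - ε) * D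
  εp<[1-ε]D {p} {D} p>0 δp≤D = begin-strict
    ε * p                                          ≡⟨ ℚ.+-identityˡ (ε * p) ⟨
    0ℚ ℚ.+ ε * p                                   <⟨ ℚ.+-monoˡ-< (ε * p) (*-pos ε>0 p>0) ⟩
    ε * p ℚ.+ ε * p                                ≡⟨ solve 2 (λ e p → e :* p :+ e :* p
                                                        := con (ℕ→ℚ 2) :* e :* p :+ con 0ℚ) refl ε p ⟩
    ℕ→ℚ 2 * ε * p ℚ.+ 0ℚ                           ≤⟨ ℚ.+-monoʳ-≤ (ℕ→ℚ 2 * ε * p)
                                                        (*-nonNeg (ℚ.<⇒≤ 2εp>0) (≤⇒0≤- 2ε≤1)) ⟩
    ℕ→ℚ 2 * ε * p ℚ.+ ℕ→ℚ 2 * ε * p * (1ℚ - ℕ→ℚ 2 * ε)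
                                                   ≡⟨ solve 2 (λ e p →
        con (ℕ→ℚ 2) :* e :* p :+ con (ℕ→ℚ 2) :* e :* p :* (con 1ℚ :- con (ℕ→ℚ 2) :* e)
          := (con 1ℚ :- e) :* (con (ℕ→ℚ 4) :* e :* p)) refl ε p ⟩
    (1ℚ - ε) * (ℕ→ℚ 4 * ε * p)                     ≤⟨ *-monoˡ-≤-nonNeg (≤⇒0≤- ε≤1)
                                                        (ℚ.≤-trans (*-monoʳ-≤-nonNeg (ℚ.<⇒≤ p>0) 4ε≤δ) δp≤D) ⟩
    (1ℚ - ε) * D                                   ∎
    where
    open ℚ.≤-Reasoning
    2εp>0 : 0ℚ < ℕ→ℚ 2 * ε * p
    2εp>0 = *-pos (ℚ.<-≤-trans ε>0 (ε≤kε {2} (ℕ.s≤s ℕ.z≤n))) p>0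
    ε≤1 : ε ≤ 1ℚ
    ε≤1 = ℚ.≤-trans (ε≤kε {2} (ℕ.s≤s ℕ.z≤n)) 2ε≤1

  three-small-parts : ∀ {b x y N w} → b ≤ ε * N → x < ε * N → y < ε * N → 0ℚ ≤ N → α * N < w →
                      b ℚ.+ (x ℚ.+ y) < w
  three-small-parts {b} {x} {y} {N} {w} b≤εN x<εN y<εN N≥0 αN<w = begin-strict
    b ℚ.+ (x ℚ.+ y)                   <⟨ ℚ.+-mono-≤-< b≤εN (ℚ.+-mono-< x<εN y<εN) ⟩
    ε * N ℚ.+ (ε * N ℚ.+ ε * N)        ≡⟨ solve 2 (λ e N → e :* N :+ (e :* N :+ e :* N) := con (ℕ→ℚ 3) :* e :* N)
                                            refl ε N ⟩
    ℕ→ℚ 3 * ε * N                     ≤⟨ *-monoʳ-≤-nonNeg N≥0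
                                            (ℚ.≤-trans (*-monoʳ-≤-nonNeg ε≥0 (ℕ→ℚ-mono-≤ (ℕ.m≤m+n 3 13))) 16ε≤α) ⟩
    α * N                              <⟨ αN<w ⟩
    w                                  ∎
    where open ℚ.≤-Reasoning

  -- If X were ε-large, regularity would give d(X,W) ≥ d(V,U) − εp, but the degree bound gives
  -- d(X,W) |W| ≤ 2ε(1 + ε) d(V,U) |U|, which is too small since |W| > α|U|.
  low-degree-small : (G : Graph n) {p : ℚ} {V U W X : Subset n} → RegularPair G ε p V U → 0ℚ < p →
                     δ * p ≤ dens G V U → W ⊆ U → α * ∣ U ∣ᵣ < ∣ W ∣ᵣ → X ⊆ V → 0ℚ < ∣ V ∣ᵣ →
                     (∀ x → x ∈ X → ∣ Nbhd G x W ∣ᵣ ≤ ℕ→ℚ 2 * ε * ((1ℚ ℚ.+ ε) * dens G V U * ∣ U ∣ᵣ)) →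
                     ∣ X ∣ᵣ < ε * ∣ V ∣ᵣ
  low-degree-small G {p} {V} {U} {W} {X} (_ , reg) p>0 δp≤D W⊆U αU<W X⊆V V>0 low =
    ℚ.≰⇒> λ X-large → low-degree-absurd {p} {dens G V U} {dens G X W} {∣ W ∣ᵣ} {∣ U ∣ᵣ} p>0 δp≤D
      (∣x-y∣≤c⇒x≤y+c (reg X W X⊆V W⊆U X-large W-large))
      (dens*∣Y∣≤K G {X} {W} (ℚ.<-≤-trans (*-pos ε>0 V>0) X-large) W>0 low)
      αU<W (∣p∣ᵣ-nonNeg U)
    where
    αU≥0 : 0ℚ ≤ α * ∣ U ∣ᵣ
    αU≥0 = *-nonNeg (ℚ.<⇒≤ α>0) (∣p∣ᵣ-nonNeg U)
    W-large : ε * ∣ U ∣ᵣ ≤ ∣ W ∣ᵣ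
    W-large = ℚ.≤-trans (*-monoʳ-≤-nonNeg (∣p∣ᵣ-nonNeg U) ε≤α) (ℚ.<⇒≤ αU<W)
    W>0 : 0ℚ < ∣ W ∣ᵣ
    W>0 = ℚ.≤-<-trans αU≥0 αU<W

-- Families of vertex-disjoint triangles

Tri : ℕ → Set
Tri n = Fin n × Fin n × Fin n

remaining : (Tri n → Fin n) → Subset n → List (Tri n) → Subset n
remaining π V ts = V ─ fromList (map π ts)

∣V∣≤∣remaining∣+length : (π : Tri n → Fin n) (V : Subset n) (ts : List (Tri n)) →
                         # V ℕ.≤ # remaining π V ts ℕ.+ length ts
∣V∣≤∣remaining∣+length π V ts = begin
  # V                                          ≤⟨ ∣p∣≤∣p─q∣+∣q∣ V (fromList (map π ts)) ⟩
  # remaining π V ts ℕ.+ # fromList (map π ts) ≤⟨ ℕ.+-monoʳ-≤ _ (∣fromList∣≤length (map π ts)) ⟩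
  # remaining π V ts ℕ.+ length (map π ts)     ≡⟨ cong (# remaining π V ts ℕ.+_) (List.length-map π ts) ⟩
  # remaining π V ts ℕ.+ length ts             ∎
  where open ℕ.≤-Reasoning

module Families (G : Graph n) {V₁ V₂ V₃ : Subset n}
         (V₁#V₂ : Disjoint V₁ V₂) (V₁#V₃ : Disjoint V₁ V₃) (V₂#V₃ : Disjoint V₂ V₃) where

  private
    apart : ∀ {X Y : Subset n} → Disjoint X Y → u ∈ X → u ∈ Y → ⊥
    apart X#Y u∈X u∈Y = X#Y (_ , x∈p∩q⁺ (u∈X , u∈Y))

  corner₁ : ∀ {x y z} → Triangle G V₁ V₂ V₃ (x , y , z) → u ∈ V₁ → u List.∈ x ∷ y ∷ z ∷ [] → u ≡ x
  corner₁ _                    _   (here refl)                 = refl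
  corner₁ (_ , y∈V₂ , _)       u∈V₁ (there (here refl))         = ⊥-elim (apart V₁#V₂ u∈V₁ y∈V₂)
  corner₁ (_ , _ , z∈V₃ , _)   u∈V₁ (there (there (here refl))) = ⊥-elim (apart V₁#V₃ u∈V₁ z∈V₃)

  corner₂ : ∀ {x y z} → Triangle G V₁ V₂ V₃ (x , y , z) → u ∈ V₂ → u List.∈ x ∷ y ∷ z ∷ [] → u ≡ y
  corner₂ (x∈V₁ , _)           u∈V₂ (here refl)                 = ⊥-elim (apart V₁#V₂ x∈V₁ u∈V₂)
  corner₂ _                    _   (there (here refl))         = refl
  corner₂ (_ , _ , z∈V₃ , _)   u∈V₂ (there (there (here refl))) = ⊥-elim (apart V₂#V₃ u∈V₂ z∈V₃)

  corner₃ : ∀ {x y z} → Triangle G V₁ V₂ V₃ (x , y , z) → u ∈ V₃ → u List.∈ x ∷ y ∷ z ∷ [] → u ≡ z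
  corner₃ (x∈V₁ , _)           u∈V₃ (here refl)                 = ⊥-elim (apart V₁#V₃ x∈V₁ u∈V₃)
  corner₃ (_ , y∈V₂ , _)       u∈V₃ (there (here refl))         = ⊥-elim (apart V₂#V₃ y∈V₂ u∈V₃)
  corner₃ _                    _   (there (there (here refl))) = refl

  ∉-triVerts : (π : Tri n → Fin n) {V : Subset n} →
               (∀ {x y z u} → Triangle G V₁ V₂ V₃ (x , y , z) → u ∈ V → u List.∈ x ∷ y ∷ z ∷ [] →
                  u ≡ π (x , y , z)) →
               ∀ {ts} → All (Triangle G V₁ V₂ V₃) ts → u ∈ V → u ∉ fromList (map π ts) →
               u List.∉ triVerts ts
  ∉-triVerts π corner {(x , y , z) ∷ ts} (tri ∷ tris) u∈V u∉ u∈ with List.∈-++⁻ (x ∷ y ∷ z ∷ []) u∈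
  ... | inj₁ u∈t  with corner tri u∈V u∈t
  ...   | refl = u∉ (x∈p∪q⁺ (inj₁ (x∈⁅x⁆ _)))
  ∉-triVerts π corner (tri ∷ tris) u∈V u∉ u∈ | inj₂ u∈ts =
    ∉-triVerts π corner tris u∈V (u∉ ∘ x∈p∪q⁺ ∘ inj₂) u∈ts

  extend-family : ∀ {ts v a b} → DisjointTriangles G V₁ V₂ V₃ ts → Triangle G V₁ V₂ V₃ (v , a , b) →
                  v ∈ remaining proj₁ V₁ ts → a ∈ remaining (proj₁ ∘ proj₂) V₂ ts →
                  b ∈ remaining (proj₂ ∘ proj₂) V₃ ts → DisjointTriangles G V₁ V₂ V₃ ((v , a , b) ∷ ts)
  extend-family {ts} {v} {a} {b} (tris , unique) tri@(v∈V₁ , a∈V₂ , b∈V₃ , _) v∈W₁ a∈W₂ b∈W₃ =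
    tri ∷ tris ,
    (v≢a ∷ v≢b ∷ unused proj₁ corner₁ v∈W₁) ∷ (a≢b ∷ unused (proj₁ ∘ proj₂) corner₂ a∈W₂) ∷
    unused (proj₂ ∘ proj₂) corner₃ b∈W₃ ∷ unique
    where
    unused : ∀ {u} (π : Tri n → Fin n) {V : Subset n} →
             (∀ {x y z u} → Triangle G V₁ V₂ V₃ (x , y , z) → u ∈ V → u List.∈ x ∷ y ∷ z ∷ [] →
                u ≡ π (x , y , z)) →
             u ∈ remaining π V ts → All (u ≢_) (triVerts ts)
    unused π {V} corner u∈W = ¬Any⇒All¬ (triVerts ts)
      (∉-triVerts π corner tris (p─q⊆p V _ u∈W) (x∈p─q⇒x∉q V _ u∈W))
    v≢a : v ≢ a
    v≢a refl = apart V₁#V₂ v∈V₁ a∈V₂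
    v≢b : v ≢ b
    v≢b refl = apart V₁#V₃ v∈V₁ b∈V₃
    a≢b : a ≢ b
    a≢b refl = apart V₂#V₃ a∈V₂ b∈V₃

-- One greedy step

module Extension {α δ ε p : ℚ} (small : Small α δ ε) (p>0 : 0ℚ < p) (G : Graph n) {V₁ V₂ V₃ : Subset n}
                 (reg₁₂ : RegularPair G ε p V₁ V₂) (reg₁₃ : RegularPair G ε p V₁ V₃)
                 (reg₂₃ : RegularPair G ε p V₂ V₃) (mostly : MostlyTypical G ε p V₁ V₂ V₃)
                 (dense : MinDensityAtLeast G (δ * p) V₁ V₂ V₃) where

  open Small small
  open Families G (proj₁ reg₁₂) (proj₁ reg₁₃) (proj₁ reg₂₃)

  m : ℚ
  m = ∣ V₁ ∣ᵣ ⊓ ∣ V₂ ∣ᵣ ⊓ ∣ V₃ ∣ᵣ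

  m≤∣V₁∣ : m ≤ ∣ V₁ ∣ᵣ
  m≤∣V₁∣ = ℚ.≤-trans (ℚ.p⊓q≤p (∣ V₁ ∣ᵣ ⊓ ∣ V₂ ∣ᵣ) ∣ V₃ ∣ᵣ) (ℚ.p⊓q≤p ∣ V₁ ∣ᵣ ∣ V₂ ∣ᵣ)

  m≤∣V₂∣ : m ≤ ∣ V₂ ∣ᵣ
  m≤∣V₂∣ = ℚ.≤-trans (ℚ.p⊓q≤p (∣ V₁ ∣ᵣ ⊓ ∣ V₂ ∣ᵣ) ∣ V₃ ∣ᵣ) (ℚ.p⊓q≤q ∣ V₁ ∣ᵣ ∣ V₂ ∣ᵣ)

  m≤∣V₃∣ : m ≤ ∣ V₃ ∣ᵣ
  m≤∣V₃∣ = ℚ.p⊓q≤q (∣ V₁ ∣ᵣ ⊓ ∣ V₂ ∣ᵣ) ∣ V₃ ∣ᵣ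

  m≥0 : 0ℚ ≤ m
  m≥0 = ℚ.⊓-glb (ℚ.⊓-glb (∣p∣ᵣ-nonNeg V₁) (∣p∣ᵣ-nonNeg V₂)) (∣p∣ᵣ-nonNeg V₃)

  target≤∣V₁∣ : (1ℚ - α) * m ≤ ∣ V₁ ∣ᵣ
  target≤∣V₁∣ = ℚ.≤-trans (+-cancelʳ-≤ (α * m) (begin
    (1ℚ - α) * m ℚ.+ α * m     ≡⟨ solve 2 (λ a m → (con 1ℚ :- a) :* m :+ a :* m := m :+ con 0ℚ) refl α m ⟩
    m ℚ.+ 0ℚ                    ≤⟨ ℚ.+-monoʳ-≤ m (*-nonNeg (ℚ.<⇒≤ α>0) m≥0) ⟩
    m ℚ.+ α * m                 ∎)) m≤∣V₁∣
    where open ℚ.≤-Reasoning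

  -- 2ε times the largest degree (1 + ε) d(V₁,V) |V| a typical vertex of V₁ can have into V.
  threshold : Subset n → ℚ
  threshold V = ℕ→ℚ 2 * ε * ((1ℚ ℚ.+ ε) * dens G V₁ V * ∣ V ∣ᵣ)

  module _ {ts : List (Tri n)} (family : DisjointTriangles G V₁ V₂ V₃ ts)
           (short : ℕ→ℚ (length ts) < (1ℚ - α) * m) where

    W₁ W₂ W₃ : Subset n
    W₁ = remaining proj₁ V₁ ts
    W₂ = remaining (proj₁ ∘ proj₂) V₂ ts
    W₃ = remaining (proj₂ ∘ proj₂) V₃ ts

    α∣V∣<∣remaining∣ : (π : Tri n → Fin n) (V : Subset n) → m ≤ ∣ V ∣ᵣ → α * ∣ V ∣ᵣ < ∣ remaining π V ts ∣ᵣ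
    α∣V∣<∣remaining∣ π V m≤V =
      remaining-large {α} {ℕ→ℚ (length ts)} {m} {∣ V ∣ᵣ} {∣ remaining π V ts ∣ᵣ}
        (ℕ→ℚ-nonNeg (length ts)) short m≥0 m≤V (begin
      ∣ V ∣ᵣ                                           ≤⟨ ℕ→ℚ-mono-≤ (∣V∣≤∣remaining∣+length π V ts) ⟩
      ℕ→ℚ (# remaining π V ts ℕ.+ length ts)           ≡⟨ ℕ→ℚ-+ (# remaining π V ts) (length ts) ⟩
      ∣ remaining π V ts ∣ᵣ ℚ.+ ℕ→ℚ (length ts)       ∎)
      where open ℚ.≤-Reasoning

    αV₁<W₁ : α * ∣ V₁ ∣ᵣ < ∣ W₁ ∣ᵣ
    αV₁<W₁ = α∣V∣<∣remaining∣ proj₁ V₁ m≤∣V₁∣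

    V₁>0 : 0ℚ < ∣ V₁ ∣ᵣ
    V₁>0 = ℚ.<-≤-trans (ℚ.≤-<-trans (*-nonNeg (ℚ.<⇒≤ α>0) (∣p∣ᵣ-nonNeg V₁)) αV₁<W₁)
                       (ℕ→ℚ-mono-≤ (p⊆q⇒∣p∣≤∣q∣ {p = W₁} {q = V₁} (p─q⊆p V₁ _)))

    low? : (V W : Subset n) (v : Fin n) → Dec (∣ Nbhd G v W ∣ᵣ < threshold V)
    low? V W v = ∣ Nbhd G v W ∣ᵣ ℚ.<? threshold V

    lowDegree : Subset n → Subset n → Subset n
    lowDegree V W = W₁ ∩ select (low? V W)

    lowDegree-small : (π : Tri n → Fin n) {V : Subset n} → RegularPair G ε p V₁ V → δ * p ≤ dens G V₁ V →
                      m ≤ ∣ V ∣ᵣ → ∣ lowDegree V (remaining π V ts) ∣ᵣ < ε * ∣ V₁ ∣ᵣ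
    lowDegree-small π {V} reg δp≤D m≤V =
      low-degree-small G {p} {V₁} {V} {W} {lowDegree V W} reg p>0 δp≤D (p─q⊆p V _) (α∣V∣<∣remaining∣ π V m≤V)
        (p─q⊆p V₁ _ ∘ p∩q⊆p W₁ _) V₁>0
        (λ x x∈ → ℚ.<⇒≤ (∈-select⁻ (low? V W) (p∩q⊆q W₁ _ x∈)))
      where W = remaining π V ts

    X₂ X₃ : Subset n
    X₂ = lowDegree V₂ W₂
    X₃ = lowDegree V₃ W₃

    B : Subset n
    B = proj₁ mostly

    good-vertex : ∃ λ v → v ∈ W₁ × v ∉ B ∪ X₂ ∪ X₃
    good-vertex = ∣q∣<∣p∣⇒∃∈p∉q W₁ (B ∪ X₂ ∪ X₃) (ℕ→ℚ-cancel-< (begin-strict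
      ∣ B ∪ X₂ ∪ X₃ ∣ᵣ                   ≤⟨ ℕ→ℚ-mono-≤ (ℕ.≤-trans (∣p∪q∣≤∣p∣+∣q∣ B (X₂ ∪ X₃))
                                               (ℕ.+-monoʳ-≤ (# B) (∣p∪q∣≤∣p∣+∣q∣ X₂ X₃))) ⟩
      ℕ→ℚ (# B ℕ.+ (# X₂ ℕ.+ # X₃))      ≡⟨ trans (ℕ→ℚ-+ (# B) _) (cong (∣ B ∣ᵣ ℚ.+_) (ℕ→ℚ-+ (# X₂) (# X₃))) ⟩
      ∣ B ∣ᵣ ℚ.+ (∣ X₂ ∣ᵣ ℚ.+ ∣ X₃ ∣ᵣ)   <⟨ three-small-parts (proj₁ (proj₂ (proj₂ mostly)))
                                               (lowDegree-small (proj₁ ∘ proj₂) reg₁₂ (proj₁ dense) m≤∣V₂∣)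
                                               (lowDegree-small (proj₂ ∘ proj₂) reg₁₃ (proj₁ (proj₂ dense)) m≤∣V₃∣)
                                               (∣p∣ᵣ-nonNeg V₁) αV₁<W₁ ⟩
      ∣ W₁ ∣ᵣ                             ∎))
      where open ℚ.≤-Reasoning

    high-degree : (V W : Subset n) {v : Fin n} → v ∈ W₁ → v ∉ lowDegree V W → threshold V ≤ ∣ Nbhd G v W ∣ᵣ
    high-degree V W v∈W₁ v∉X = ℚ.≮⇒≥ (λ low → v∉X (x∈p∩q⁺ (v∈W₁ , ∈-select⁺ (low? V W) low)))

    triangle-at : ∀ {v} → v ∈ W₁ → v ∉ X₂ → v ∉ X₃ → TypicalVertex G ε p V₁ V₂ V₃ v →
                  Σ (Tri n) λ t → DisjointTriangles G V₁ V₂ V₃ (t ∷ ts)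
    triangle-at {v} v∈W₁ v∉X₂ v∉X₃
      ((_ , N₂≤) , (_ , N₃≤) , N₂′ , N₃′ , N₂′⊆N₂ , N₃′⊆N₃ , N₂′-large , N₃′-large , N′-regular , N′-dense , _) =
      close (regular-pair-edge G {ε} {p} {N₂′} {N₃′} {N₂′ ∩ W₂} {N₃′ ∩ W₃} N′-regular εp<d
               (p∩q⊆p N₂′ W₂) (p∩q⊆p N₃′ W₃) survives₂ survives₃)
      where
      εp<d : ε * p < dens G N₂′ N₃′
      εp<d = ℚ.<-≤-trans (εp<[1-ε]D p>0 (proj₂ (proj₂ dense))) N′-dense
      survives₂ : ε * ∣ N₂′ ∣ᵣ ≤ ∣ N₂′ ∩ W₂ ∣ᵣ
      survives₂ = neighbourhood-survives G ε≥0 (p─q⊆p V₂ _) N₂′⊆N₂ N₂′-large N₂≤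
                    (high-degree V₂ W₂ v∈W₁ v∉X₂)
      survives₃ : ε * ∣ N₃′ ∣ᵣ ≤ ∣ N₃′ ∩ W₃ ∣ᵣ
      survives₃ = neighbourhood-survives G ε≥0 (p─q⊆p V₃ _) N₃′⊆N₃ N₃′-large N₃≤
                    (high-degree V₃ W₃ v∈W₁ v∉X₃)
      close : (∃₂ λ a b → a ∈ N₂′ ∩ W₂ × b ∈ N₃′ ∩ W₃ × adj G a b ≡ true) →
              Σ (Tri n) λ t → DisjointTriangles G V₁ V₂ V₃ (t ∷ ts)
      close (a , b , a∈ , b∈ , ab) = (v , a , b) , extend-family family tri v∈W₁ a∈W₂ b∈W₃
        where
        a∈W₂ : a ∈ W₂
        a∈W₂ = p∩q⊆q N₂′ W₂ a∈
        b∈W₃ : b ∈ W₃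
        b∈W₃ = p∩q⊆q N₃′ W₃ b∈
        tri : Triangle G V₁ V₂ V₃ (v , a , b)
        tri = p─q⊆p V₁ _ v∈W₁ , p─q⊆p V₂ _ a∈W₂ , p─q⊆p V₃ _ b∈W₃ ,
              proj₁ (∈-Nbhd⁻ {p = V₂} G (N₂′⊆N₂ (p∩q⊆p N₂′ W₂ a∈))) , ab ,
              proj₁ (∈-Nbhd⁻ {p = V₃} G (N₃′⊆N₃ (p∩q⊆p N₃′ W₃ b∈)))

    extend : Σ (Tri n) λ t → DisjointTriangles G V₁ V₂ V₃ (t ∷ ts)
    extend =
      let v , v∈W₁ , v∉B∪X = good-vertex
          v∉B  = v∉B∪X ∘ x∈p∪q⁺ ∘ inj₁
          v∉X₂ = v∉B∪X ∘ x∈p∪q⁺ ∘ inj₂ ∘ x∈p∪q⁺ ∘ inj₁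
          v∉X₃ = v∉B∪X ∘ x∈p∪q⁺ ∘ inj₂ ∘ x∈p∪q⁺ ∘ inj₂
      in triangle-at v∈W₁ v∉X₂ v∉X₃ (proj₂ (proj₂ (proj₂ mostly)) v (p─q⊆p V₁ _ v∈W₁) v∉B)

module Greedy {A : Set} (R : List A → Set) (target : ℚ) (R[] : R [])
              (step : ∀ {xs} → R xs → ℕ→ℚ (length xs) < target → Σ A λ x → R (x ∷ xs)) where

  Progress : ℕ → Set
  Progress k = Σ (List A) λ xs → R xs × (target ≤ ℕ→ℚ (length xs) ⊎ k ℕ.≤ length xs)

  step-unless-done : ∀ {k xs} → R xs → k ℕ.≤ length xs → Dec (target ≤ ℕ→ℚ (length xs)) →
                     Progress (ℕ.suc k)
  step-unless-done {xs = xs} Rxs k≤ (yes done) = xs , Rxs , inj₁ done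
  step-unless-done {xs = xs} Rxs k≤ (no short) =
    let x , Rx = step Rxs (ℚ.≰⇒> short) in x ∷ xs , Rx , inj₂ (ℕ.s≤s k≤)

  grow : ∀ k → Progress k
  grow ℕ.zero    = [] , R[] , inj₂ ℕ.z≤n
  grow (ℕ.suc k) with grow k
  ... | xs , Rxs , inj₁ done = xs , Rxs , inj₁ done
  ... | xs , Rxs , inj₂ k≤   = step-unless-done Rxs k≤ (target ℚ.≤? ℕ→ℚ (length xs))

  reach : ∀ k → target ≤ ℕ→ℚ k → Σ (List A) λ xs → R xs × target ≤ ℕ→ℚ (length xs)
  reach k target≤k with grow k
  ... | xs , Rxs , inj₁ done = xs , Rxs , done
  ... | xs , Rxs , inj₂ k≤   = xs , Rxs , ℚ.≤-trans target≤k (ℕ→ℚ-mono-≤ k≤)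

small-choice : ∀ {α δ} → 0ℚ < α → 0ℚ < δ → Small α δ ((α ⊓ δ ⊓ 1ℚ) * (+ 1 ℚ./ 16))
small-choice {α} {δ} α>0 δ>0 = record
  { ε>0   = *-pos (⊓-pos (⊓-pos α>0 δ>0) (ℚ.positive⁻¹ 1ℚ)) (ℚ.positive⁻¹ (+ 1 ℚ./ 16))
  ; 16ε≤α = ℚ.≤-trans (k[c/16]≤c ℕ.≤-refl) (ℚ.≤-trans (ℚ.p⊓q≤p (α ⊓ δ) 1ℚ) (ℚ.p⊓q≤p α δ))
  ; 4ε≤δ  = ℚ.≤-trans (k[c/16]≤c (ℕ.m≤n+m 4 12)) (ℚ.≤-trans (ℚ.p⊓q≤p (α ⊓ δ) 1ℚ) (ℚ.p⊓q≤q α δ))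
  ; 2ε≤1  = ℚ.≤-trans (k[c/16]≤c (ℕ.m≤n+m 2 14)) (ℚ.p⊓q≤q (α ⊓ δ) 1ℚ)
  }
  where
  c : ℚ
  c = α ⊓ δ ⊓ 1ℚ
  c≥0 : 0ℚ ≤ c
  c≥0 = ℚ.<⇒≤ (⊓-pos (⊓-pos α>0 δ>0) (ℚ.positive⁻¹ 1ℚ))
  k[c/16]≤c : ∀ {k} → k ℕ.≤ 16 → ℕ→ℚ k * (c * (+ 1 ℚ./ 16)) ≤ c
  k[c/16]≤c k≤16 = ℚ.≤-trans (*-monoʳ-≤-nonNeg (*-nonNeg c≥0 (ℚ.<⇒≤ (ℚ.positive⁻¹ (+ 1 ℚ./ 16)))) (ℕ→ℚ-mono-≤ k≤16))
    (ℚ.≤-reflexive (solve 1 (λ c → con (ℕ→ℚ 16) :* (c :* con (+ 1 ℚ./ 16)) := c) refl c))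

many-disjoint-triangles : ∀ {α δ ε p} → Small α δ ε → 0ℚ < p → (G : Graph n) (V₁ V₂ V₃ : Subset n) →
                          TypicalTriple G ε p V₁ V₂ V₃ → MinDensityAtLeast G (δ * p) V₁ V₂ V₃ →
                          Σ (List (Tri n)) λ ts → DisjointTriangles G V₁ V₂ V₃ ts ×
                            (1ℚ - α) * (∣ V₁ ∣ᵣ ⊓ ∣ V₂ ∣ᵣ ⊓ ∣ V₃ ∣ᵣ) ≤ ℕ→ℚ (length ts)
many-disjoint-triangles {α = α} small p>0 G V₁ V₂ V₃ ((reg₁₂ , reg₁₃ , reg₂₃) , mostly , _) dense =
  Greedy.reach (DisjointTriangles G V₁ V₂ V₃) ((1ℚ - α) * m) ([] , []) extend (# V₁) target≤∣V₁∣
  where open Extension small p>0 G reg₁₂ reg₁₃ reg₂₃ mostly dense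

proposition2p7 : (α δ : ℚ) → 0ℚ < α → 0ℚ < δ →
    Σ ℚ λ ε → 0ℚ < ε ×
      ((p : ℚ) → 0ℚ < p →
       (n : ℕ) (G : Graph n) (V₁ V₂ V₃ : Subset n) →
       TypicalTriple G ε p V₁ V₂ V₃ →
       MinDensityAtLeast G (δ * p) V₁ V₂ V₃ →
       Σ (List (Fin n × Fin n × Fin n)) λ ts →
         DisjointTriangles G V₁ V₂ V₃ ts ×
         (1ℚ - α) * (∣ V₁ ∣ᵣ ⊓ ∣ V₂ ∣ᵣ ⊓ ∣ V₃ ∣ᵣ) ≤ ℕ→ℚ (length ts))
proposition2p7 α δ α>0 δ>0 =
  (α ⊓ δ ⊓ 1ℚ) * (+ 1 ℚ./ 16) , Small.ε>0 small ,
  λ p p>0 n → many-disjoint-triangles small p>0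
  where
  small : Small α δ ((α ⊓ δ ⊓ 1ℚ) * (+ 1 ℚ./ 16))
  small = small-choice α>0 δ>0
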